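{- There exist finite simplicial complexes whose face poset is not isomorphic to the path poset $P(G)$ of any multigraph $G$; equivalently, there is a finite simplicial complex $Y$ such that $Y$ is not isomorphic to the multipath complex $X(G)$ of any multigraph $G$.
   Context: A multigraph (quiver) is a tuple $(V,E,s,t)$ with $V,E$ finite sets and $s,t\colon E\to V$ with $s(e)\neq t(e)$ for all $e$ (multiple edges between two vertices allowed). A simple path is a sequence of edges $e_1,\dots,e_n$ with $s(e_{i+1})=t(e_i)$, no vertex encountered twice, and $s(e_1)\ne t(e_n)$. A multipath is a spanning subgraph each of whose connected components is a single vertex or has edges forming a simple path in some order; the path poset $P(G)$ is the set of multipaths ordered by inclusion. The multipath complex $X(G)$ is the abstract simplicial complex on $E(G)$ whose simplices are the edge sets of multipaths. The face poset of a simplicial complex is its set of simplices (including the empty simplex) ordered by inclusion. -}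

module Defs where

open import Data.Nat using (ℕ)
open import Data.Fin using (Fin)
open import Data.Fin.Subset using (Subset; _⊆_; _∈_; ⊥; ⁅_⁆)
open import Data.Vec using (tabulate; lookup)
open import Data.List using (List; []; _∷_; map; concat)
import Data.List.Membership.Propositional as LM
open import Data.List.Relation.Unary.All using (All)
open import Data.List.Relation.Unary.AllPairs using (AllPairs)
open import Data.List.Relation.Unary.Linked using (Linked)
open import Data.List.Relation.Unary.Unique.Propositional using (Unique)
open import Data.Product using (Σ; _×_)
open import Relation.Binary.PropositionalEquality using (_≡_; _≢_)
open import Relation.Nullary using (¬_)
open import Function.Bundles using (_⇔_)

record Multigraph : Set where
  field
    nV nE    : ℕ
    src tgt  : Fin nE → Fin nV
    loopless : ∀ e → src e ≢ tgt e

module _ (G : Multigraph) where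
  open Multigraph G

  pathVertices : List (Fin nE) → List (Fin nV)
  pathVertices []       = []
  pathVertices (e ∷ es) = src e ∷ map tgt (e ∷ es)

  -- simple path: nonempty, s(e_{i+1}) = t(e_i), no vertex encountered
  -- twice (which in particular forces s(e₁) ≠ t(eₙ)).
  IsSimplePath : List (Fin nE) → Set
  IsSimplePath p =
    (p ≢ []) × Linked (λ e f → src f ≡ tgt e) p × Unique (pathVertices p)

  -- The spanning subgraph with edge set σ is a multipath: its edges split
  -- into simple paths with pairwise disjoint vertex sets (these are the
  -- non-trivial connected components; all other components are isolated
  -- vertices).
  IsMultipath : Subset nE → Set
  IsMultipath σ =
    Σ (List (List (Fin nE))) λ ps →
      All IsSimplePath ps
      × AllPairs (λ p q → ∀ v → v LM.∈ pathVertices p → ¬ (v LM.∈ pathVertices q)) ps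
      × (∀ e → (e ∈ σ) ⇔ (e LM.∈ concat ps))

record SimplicialComplex : Set₁ where
  field
    n      : ℕ
    face   : Subset n → Set
    face-∅ : face ⊥
    face-v : ∀ i → face ⁅ i ⁆
    down   : ∀ {σ τ} → σ ⊆ τ → face τ → face σ

record SCIso (n : ℕ) (F : Subset n → Set) (m : ℕ) (H : Subset m → Set) : Set where
  field
    to        : Fin n → Fin m
    from      : Fin m → Fin n
    from∘to   : ∀ i → from (to i) ≡ i
    to∘from   : ∀ j → to (from j) ≡ j
    face-pres : ∀ σ → F σ ⇔ H (tabulate (λ j → lookup σ (from j)))

record PosetIso (n : ℕ) (F : Subset n → Set) (m : ℕ) (H : Subset m → Set) : Set where
  field
    f      : (σ : Subset n) → F σ → Subset m
    f-in   : ∀ σ (p : F σ) → H (f σ p)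
    g      : (τ : Subset m) → H τ → Subset n
    g-in   : ∀ τ (q : H τ) → F (g τ q)
    g∘f    : ∀ σ (p : F σ) → g (f σ p) (f-in σ p) ≡ σ
    f∘g    : ∀ τ (q : H τ) → f (g τ q) (g-in τ q) ≡ τ
    f-mono : ∀ σ p σ' p' → σ ⊆ σ' → f σ p ⊆ f σ' p'
    g-mono : ∀ τ q τ' q' → τ ⊆ τ' → g τ q ⊆ g τ' q'

FacePosetIsoPathPoset : SimplicialComplex → Multigraph → Set
FacePosetIsoPathPoset Y G =
  PosetIso (SimplicialComplex.n Y) (SimplicialComplex.face Y)
           (Multigraph.nE G) (IsMultipath G)

IsoMultipathComplex : SimplicialComplex → Multigraph → Set
IsoMultipathComplex Y G =
  SCIso (SimplicialComplex.n Y) (SimplicialComplex.face Y)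
        (Multigraph.nE G) (IsMultipath G)

-- Let Y be a point together with a disjoint tetrahedron. A poset isomorphism
-- between faces and multipaths sends vertices of Y to single edges of G. Two
-- edges fail to form a multipath exactly when they conflict: they share a
-- source, share a target, or form a 2-cycle. So the edge e₀ of the isolated
-- vertex conflicts with each of the four edges of the tetrahedron's vertices,
-- while these four pairwise do not conflict. By pigeonhole two of them conflict
-- with e₀ in the same one of the three ways, and then they conflict with each
-- other (for 2-cycles through e₀: both start at the target of e₀).
module Submission where

open import Defs
open import Data.Empty using (⊥-elim)
open import Data.Fin using (Fin; zero; suc; _≟_)
open import Data.Fin.Patterns using (0F; 1F; 2F)
open import Data.Fin.Properties using (pigeonhole; <⇒≢; suc-injective)
open import Data.Fin.Subset using (Subset; _⊆_; _∈_; _∉_; ⊥; ⁅_⁆; _∪_; Nonempty)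
open import Data.Fin.Subset.Properties
  using (∉⊥; ⊥⊆; x∈⁅x⁆; x∈⁅y⁆⇒x≡y; x∈p∪q⁻; x∈p∪q⁺; ∪-comm; nonempty?)
open import Data.List using (List; []; _∷_; map; concat)
import Data.List.Membership.Propositional as List
open import Data.List.Membership.Propositional.Properties using (∈-map⁺; ∈-++⁻; ∈-concat⁻′)
open import Data.List.Relation.Unary.Any using (here; there)
open import Data.List.Relation.Unary.All as All using (All; []; _∷_)
open import Data.List.Relation.Unary.AllPairs using (AllPairs; []; _∷_)
open import Data.List.Relation.Unary.Linked as Linked using (Linked; []; [-]; _∷_)
open import Data.List.Relation.Unary.Unique.Propositional using (Unique)
open import Data.Nat.Properties using (n<1+n)
open import Data.Product using (Σ; _×_; _,_; proj₁; proj₂)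
open import Data.Sum using (_⊎_; inj₁; inj₂)
open import Data.Vec using (tabulate; lookup)
open import Data.Vec.Properties using (lookup∘tabulate; tabulate∘lookup; tabulate-cong; []=⇒lookup; lookup⇒[]=)
open import Function using (_∘_)
open import Function.Bundles using (_⇔_; mk⇔; Equivalence)
open import Relation.Binary.PropositionalEquality using (_≡_; _≢_; refl; sym; trans; cong; subst)
open import Relation.Nullary using (¬_; yes; no; contradiction)

⁅⁆⊆ : ∀ {n} {x : Fin n} {p : Subset n} → x ∈ p → ⁅ x ⁆ ⊆ p
⁅⁆⊆ {x = x} {p} x∈p y∈⁅x⁆ = subst (_∈ p) (sym (x∈⁅y⁆⇒x≡y x y∈⁅x⁆)) x∈p

∈⁅⁆⇔ : ∀ {n} (e x : Fin n) → x ∈ ⁅ e ⁆ ⇔ x List.∈ e ∷ []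
∈⁅⁆⇔ e x = mk⇔ (here ∘ x∈⁅y⁆⇒x≡y e) λ { (here refl) → x∈⁅x⁆ e }

∈⁅⁆∪⁅⁆⇔ : ∀ {n} (e f x : Fin n) → x ∈ ⁅ e ⁆ ∪ ⁅ f ⁆ ⇔ x List.∈ e ∷ f ∷ []
∈⁅⁆∪⁅⁆⇔ e f x = mk⇔ to from
  where
  to : x ∈ ⁅ e ⁆ ∪ ⁅ f ⁆ → x List.∈ e ∷ f ∷ []
  to x∈ with x∈p∪q⁻ ⁅ e ⁆ ⁅ f ⁆ x∈
  ... | inj₁ x∈⁅e⁆ = here (x∈⁅y⁆⇒x≡y e x∈⁅e⁆)
  ... | inj₂ x∈⁅f⁆ = there (here (x∈⁅y⁆⇒x≡y f x∈⁅f⁆))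
  from : x List.∈ e ∷ f ∷ [] → x ∈ ⁅ e ⁆ ∪ ⁅ f ⁆
  from (here refl)         = x∈p∪q⁺ (inj₁ (x∈⁅x⁆ e))
  from (there (here refl)) = x∈p∪q⁺ {p = ⁅ e ⁆} (inj₂ (x∈⁅x⁆ f))

relabel : ∀ {n m} → (Fin m → Fin n) → Subset n → Subset m
relabel π σ = tabulate (λ j → lookup σ (π j))

module _ {n m} (π : Fin m → Fin n) {σ : Subset n} where

  ∈-relabel⁺ : ∀ {j} → π j ∈ σ → j ∈ relabel π σ
  ∈-relabel⁺ {j} πj∈σ = lookup⇒[]= j _ (trans (lookup∘tabulate _ j) ([]=⇒lookup πj∈σ))

  ∈-relabel⁻ : ∀ {j} → j ∈ relabel π σ → π j ∈ σ
  ∈-relabel⁻ {j} j∈ = lookup⇒[]= (π j) σ (trans (sym (lookup∘tabulate _ j)) ([]=⇒lookup j∈))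

relabel-mono : ∀ {n m} (π : Fin m → Fin n) {σ σ′ : Subset n} → σ ⊆ σ′ → relabel π σ ⊆ relabel π σ′
relabel-mono π σ⊆σ′ = ∈-relabel⁺ π ∘ σ⊆σ′ ∘ ∈-relabel⁻ π

relabel-inverse : ∀ {n m} (π : Fin m → Fin n) (ρ : Fin n → Fin m) →
                  (∀ i → π (ρ i) ≡ i) → ∀ σ → relabel ρ (relabel π σ) ≡ σ
relabel-inverse π ρ πρ σ =
  trans (tabulate-cong λ i → trans (lookup∘tabulate _ (ρ i)) (cong (lookup σ) (πρ i)))
        (tabulate∘lookup σ)

SCIso⇒PosetIso : ∀ {n F m H} → SCIso n F m H → PosetIso n F m H
SCIso⇒PosetIso {H = H} I = record
  { f      = λ σ _ → relabel from σ
  ; f-in   = λ σ → Equivalence.to (face-pres σ)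
  ; g      = λ τ _ → relabel to τ
  ; g-in   = λ τ q → Equivalence.from (face-pres (relabel to τ))
                                      (subst H (sym (relabel-inverse to from to∘from τ)) q)
  ; g∘f    = λ σ _ → relabel-inverse from to from∘to σ
  ; f∘g    = λ τ _ → relabel-inverse to from to∘from τ
  ; f-mono = λ _ _ _ _ → relabel-mono from
  ; g-mono = λ _ _ _ _ → relabel-mono to
  }
  where open SCIso I

PosetIso-sym : ∀ {n F m H} → PosetIso n F m H → PosetIso m H n F
PosetIso-sym P = record
  { f = g ; f-in = g-in ; g = f ; g-in = f-in
  ; g∘f = f∘g ; f∘g = g∘f ; f-mono = g-mono ; g-mono = f-mono }
  where open PosetIso P

module _ {n F m H} (P : PosetIso n F m H) (F⊥ : F ⊥) (H⊥ : H ⊥) where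
  open PosetIso P

  g⊥⊆⊥ : g ⊥ H⊥ ⊆ ⊥
  g⊥⊆⊥ = subst (g ⊥ H⊥ ⊆_) (g∘f ⊥ F⊥) (g-mono ⊥ H⊥ (f ⊥ F⊥) (f-in ⊥ F⊥) ⊥⊆)

  f-nonempty : ∀ σ p → Nonempty σ → Nonempty (f σ p)
  f-nonempty σ p (i , i∈σ) with nonempty? (f σ p)
  ... | yes fσ≢∅ = fσ≢∅
  ... | no  fσ≡∅ = contradiction (g⊥⊆⊥ (g-mono _ _ ⊥ H⊥ fσ⊆⊥ i∈gfσ)) ∉⊥
    where
    fσ⊆⊥ : f σ p ⊆ ⊥
    fσ⊆⊥ x∈ = contradiction (_ , x∈) fσ≡∅
    i∈gfσ : i ∈ g (f σ p) (f-in σ p)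
    i∈gfσ = subst (i ∈_) (sym (g∘f σ p)) i∈σ

module Atoms {n F m H} (P : PosetIso n F m H) (F⊥ : F ⊥) (H⊥ : H ⊥)
             (F-vertex : ∀ i → F ⁅ i ⁆) (H-vertex : ∀ e → H ⁅ e ⁆) where
  open PosetIso P

  atom : Fin n → Fin m
  atom i = proj₁ (f-nonempty P F⊥ H⊥ ⁅ i ⁆ (F-vertex i) (i , x∈⁅x⁆ i))

  atom∈f : ∀ {i} σ p → i ∈ σ → atom i ∈ f σ p
  atom∈f {i} σ p i∈σ = f-mono ⁅ i ⁆ (F-vertex i) σ p (⁅⁆⊆ i∈σ)
                              (proj₂ (f-nonempty P F⊥ H⊥ ⁅ i ⁆ (F-vertex i) (i , x∈⁅x⁆ i)))

  g⁅atom⁆⊆⁅⁆ : ∀ i → g ⁅ atom i ⁆ (H-vertex (atom i)) ⊆ ⁅ i ⁆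
  g⁅atom⁆⊆⁅⁆ i = subst (g ⁅ atom i ⁆ (H-vertex (atom i)) ⊆_) (g∘f ⁅ i ⁆ (F-vertex i))
                       (g-mono _ _ _ _ (⁅⁆⊆ (atom∈f ⁅ i ⁆ (F-vertex i) (x∈⁅x⁆ i))))

  ∈g⁅atom⁆ : ∀ i → i ∈ g ⁅ atom i ⁆ (H-vertex (atom i))
  ∈g⁅atom⁆ i with f-nonempty (PosetIso-sym P) H⊥ F⊥ ⁅ atom i ⁆ (H-vertex (atom i)) (atom i , x∈⁅x⁆ _)
  ... | j , j∈ = subst (_∈ g ⁅ atom i ⁆ (H-vertex (atom i))) (x∈⁅y⁆⇒x≡y i (g⁅atom⁆⊆⁅⁆ i j∈)) j∈

  atom∈⇒∈g : ∀ {i} τ q → atom i ∈ τ → i ∈ g τ q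
  atom∈⇒∈g {i} τ q atom∈τ = g-mono _ _ τ q (⁅⁆⊆ atom∈τ) (∈g⁅atom⁆ i)

  atom-injective : ∀ {i j} → atom i ≡ atom j → i ≡ j
  atom-injective {i} {j} eq =
    x∈⁅y⁆⇒x≡y j (g⁅atom⁆⊆⁅⁆ j (atom∈⇒∈g _ _ (subst (_∈ ⁅ atom j ⁆) (sym eq) (x∈⁅x⁆ (atom j)))))

module _ (G : Multigraph) where
  open Multigraph G

  data Conflict (e f : Fin nE) : Set where
    sameSource   : src e ≡ src f → Conflict e f
    sameTarget   : tgt e ≡ tgt f → Conflict e f
    antiparallel : src e ≡ tgt f → tgt e ≡ src f → Conflict e f

  conflict-sym : ∀ {e f} → Conflict e f → Conflict f e
  conflict-sym (sameSource eq)       = sameSource (sym eq)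
  conflict-sym (sameTarget eq)       = sameTarget (sym eq)
  conflict-sym (antiparallel eq eq′) = antiparallel (sym eq′) (sym eq)

  conflictKind : ∀ {e f} → Conflict e f → Fin 3
  conflictKind (sameSource _)     = 0F
  conflictKind (sameTarget _)     = 1F
  conflictKind (antiparallel _ _) = 2F

  sameKind⇒conflict : ∀ {a x y} (c : Conflict a x) (d : Conflict a y) →
                      conflictKind c ≡ conflictKind d → Conflict x y
  sameKind⇒conflict (sameSource p)     (sameSource q)     _ = sameSource (trans (sym p) q)
  sameKind⇒conflict (sameTarget p)     (sameTarget q)     _ = sameTarget (trans (sym p) q)
  sameKind⇒conflict (antiparallel _ p) (antiparallel _ q) _ = sameSource (trans (sym p) q)
  sameKind⇒conflict (sameSource _)     (sameTarget _)     ()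
  sameKind⇒conflict (sameSource _)     (antiparallel _ _) ()
  sameKind⇒conflict (sameTarget _)     (sameSource _)     ()
  sameKind⇒conflict (sameTarget _)     (antiparallel _ _) ()
  sameKind⇒conflict (antiparallel _ _) (sameSource _)     ()
  sameKind⇒conflict (antiparallel _ _) (sameTarget _)     ()

  Consecutive : Fin nE → Fin nE → Set
  Consecutive e f = src f ≡ tgt e

  Disjoint : List (Fin nE) → List (Fin nE) → Set
  Disjoint p q = ∀ v → v List.∈ pathVertices G p → ¬ v List.∈ pathVertices G q

  tgt∈pathVertices : ∀ {e p} → e List.∈ p → tgt e List.∈ pathVertices G p
  tgt∈pathVertices {p = _ ∷ _} e∈p = there (∈-map⁺ tgt e∈p)

  pathVertices⊆targets : ∀ {e p v} → Linked Consecutive (e ∷ p) →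
                         v List.∈ pathVertices G p → v List.∈ map tgt (e ∷ p)
  pathVertices⊆targets {p = _ ∷ _} (r ∷ _) (here refl) = here r
  pathVertices⊆targets {p = _ ∷ _} _       (there v∈)  = there v∈

  src∈pathVertices : ∀ {e p} → Linked Consecutive p → e List.∈ p → src e List.∈ pathVertices G p
  src∈pathVertices {p = _ ∷ _} _ (here refl) = here refl
  src∈pathVertices {p = _ ∷ _} l (there e∈p) =
    there (pathVertices⊆targets l (src∈pathVertices (Linked.tail l) e∈p))

  pathVertices-unique-tail : ∀ {e p} → Linked Consecutive (e ∷ p) →
                             Unique (pathVertices G (e ∷ p)) → Unique (pathVertices G p)
  pathVertices-unique-tail {p = []}         _       _       = []
  pathVertices-unique-tail {p = f ∷ fs} (r ∷ _) (_ ∷ u) =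
    subst (λ v → Unique (v ∷ map tgt (f ∷ fs))) (sym r) u

  head-conflictFree : ∀ {e p x} → Linked Consecutive (e ∷ p) → Unique (pathVertices G (e ∷ p)) →
                      x List.∈ p → ¬ Conflict e x
  head-conflictFree l (src∉ ∷ _ ∷ _) x∈p (sameSource eq) =
    All.lookup src∉ (pathVertices⊆targets l (src∈pathVertices (Linked.tail l) x∈p)) eq
  head-conflictFree l (_ ∷ tgt∉ ∷ _) x∈p (sameTarget eq) =
    All.lookup tgt∉ (∈-map⁺ tgt x∈p) eq
  head-conflictFree l (src∉ ∷ _ ∷ _) x∈p (antiparallel eq _) =
    All.lookup src∉ (there (∈-map⁺ tgt x∈p)) eq

  path-conflictFree : ∀ {p e f} → Linked Consecutive p → Unique (pathVertices G p) →
                      e List.∈ p → f List.∈ p → e ≢ f → ¬ Conflict e f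
  path-conflictFree _ _ (here refl) (here refl) e≢f = contradiction refl e≢f
  path-conflictFree l u (here refl) (there f∈)  _   = head-conflictFree l u f∈
  path-conflictFree l u (there e∈)  (here refl) _   = head-conflictFree l u e∈ ∘ conflict-sym
  path-conflictFree l u (there e∈)  (there f∈)  e≢f =
    path-conflictFree (Linked.tail l) (pathVertices-unique-tail l u) e∈ f∈ e≢f

  disjoint-conflictFree : ∀ {p q e f} → Linked Consecutive p → Linked Consecutive q → Disjoint p q →
                          e List.∈ p → f List.∈ q → ¬ Conflict e f
  disjoint-conflictFree lp lq d e∈ f∈ (sameSource eq) =
    d _ (src∈pathVertices lp e∈) (subst (List._∈ pathVertices G _) (sym eq) (src∈pathVertices lq f∈))
  disjoint-conflictFree lp lq d e∈ f∈ (sameTarget eq) =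
    d _ (tgt∈pathVertices e∈) (subst (List._∈ pathVertices G _) (sym eq) (tgt∈pathVertices f∈))
  disjoint-conflictFree lp lq d e∈ f∈ (antiparallel eq _) =
    d _ (src∈pathVertices lp e∈) (subst (List._∈ pathVertices G _) (sym eq) (tgt∈pathVertices f∈))

  disjointFromAll-conflictFree : ∀ {p qs e f} → Linked Consecutive p → All (IsSimplePath G) qs →
                                 All (Disjoint p) qs → e List.∈ p → f List.∈ concat qs → ¬ Conflict e f
  disjointFromAll-conflictFree {qs = qs} lp sqs ds e∈ f∈ with ∈-concat⁻′ qs f∈
  ... | q , f∈q , q∈qs =
    disjoint-conflictFree lp (proj₁ (proj₂ (All.lookup sqs q∈qs))) (All.lookup ds q∈qs) e∈ f∈q

  paths-conflictFree : ∀ ps {e f} → All (IsSimplePath G) ps → AllPairs Disjoint ps →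
                       e List.∈ concat ps → f List.∈ concat ps → e ≢ f → ¬ Conflict e f
  paths-conflictFree (p ∷ ps) (sp@(_ , lp , up) ∷ sps) (ds ∷ dss) e∈ f∈ e≢f
    with ∈-++⁻ p e∈ | ∈-++⁻ p f∈
  ... | inj₁ e∈p  | inj₁ f∈p  = path-conflictFree lp up e∈p f∈p e≢f
  ... | inj₁ e∈p  | inj₂ f∈ps = disjointFromAll-conflictFree lp sps ds e∈p f∈ps
  ... | inj₂ e∈ps | inj₁ f∈p  = disjointFromAll-conflictFree lp sps ds f∈p e∈ps ∘ conflict-sym
  ... | inj₂ e∈ps | inj₂ f∈ps = paths-conflictFree ps sps dss e∈ps f∈ps e≢f

  multipath-conflictFree : ∀ {σ e f} → IsMultipath G σ → e ∈ σ → f ∈ σ → e ≢ f → ¬ Conflict e f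
  multipath-conflictFree (ps , sps , dps , ∈σ⇔) e∈ f∈ =
    paths-conflictFree ps sps dps (Equivalence.to (∈σ⇔ _) e∈) (Equivalence.to (∈σ⇔ _) f∈)

  oneEdgePath : ∀ e → IsSimplePath G (e ∷ [])
  oneEdgePath e = (λ ()) , [-] , (loopless e ∷ []) ∷ [] ∷ []

  twoEdgePath : ∀ {e f} → tgt e ≡ src f → src e ≢ tgt f → IsSimplePath G (e ∷ f ∷ [])
  twoEdgePath {e} {f} r s≢t =
    (λ ()) , (sym r ∷ [-]) ,
    (loopless e ∷ s≢t ∷ []) ∷ (loopless f ∘ trans (sym r) ∷ []) ∷ [] ∷ []

  ∅-isMultipath : IsMultipath G ⊥
  ∅-isMultipath = [] , [] , [] , λ _ → mk⇔ (λ x∈⊥ → contradiction x∈⊥ ∉⊥) λ ()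

  ⁅⁆-isMultipath : ∀ e → IsMultipath G ⁅ e ⁆
  ⁅⁆-isMultipath e = (e ∷ []) ∷ [] , oneEdgePath e ∷ [] , [] ∷ [] , ∈⁅⁆⇔ e

  conflict⊎pair-isMultipath : ∀ e f → Conflict e f ⊎ IsMultipath G (⁅ e ⁆ ∪ ⁅ f ⁆)
  conflict⊎pair-isMultipath e f with src e ≟ src f | tgt e ≟ tgt f | src e ≟ tgt f | tgt e ≟ src f
  ... | yes ss | _      | _      | _      = inj₁ (sameSource ss)
  ... | no _   | yes tt | _      | _      = inj₁ (sameTarget tt)
  ... | no _   | no _   | yes st | yes ts = inj₁ (antiparallel st ts)
  ... | no _   | no _   | yes st | no ts  =
    inj₂ (subst (IsMultipath G) (∪-comm ⁅ f ⁆ ⁅ e ⁆)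
      ((f ∷ e ∷ []) ∷ [] , twoEdgePath (sym st) (ts ∘ sym) ∷ [] , [] ∷ [] , ∈⁅⁆∪⁅⁆⇔ f e))
  ... | no _   | no tt | no st  | yes ts =
    inj₂ ((e ∷ f ∷ []) ∷ [] , twoEdgePath ts st ∷ [] , [] ∷ [] , ∈⁅⁆∪⁅⁆⇔ e f)
  ... | no ss  | no tt | no st  | no ts  =
    inj₂ ((e ∷ []) ∷ (f ∷ []) ∷ [] , oneEdgePath e ∷ oneEdgePath f ∷ [] ,
          (disjoint ∷ []) ∷ [] ∷ [] , ∈⁅⁆∪⁅⁆⇔ e f)
    where
    disjoint : Disjoint (e ∷ []) (f ∷ [])
    disjoint _ (here refl)         (here eq)         = ss eq
    disjoint _ (here refl)         (there (here eq)) = st eq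
    disjoint _ (there (here refl)) (here eq)         = ts eq
    disjoint _ (there (here refl)) (there (here eq)) = tt eq

-- Vertex 0 is an isolated point; vertices 1–4 span a tetrahedron.
PointOrTetrahedronFace : Subset 5 → Set
PointOrTetrahedronFace σ = zero ∈ σ → ∀ i → suc i ∉ σ

pointAndTetrahedron : SimplicialComplex
pointAndTetrahedron = record
  { n      = 5
  ; face   = PointOrTetrahedronFace
  ; face-∅ = λ 0∈⊥ → contradiction 0∈⊥ ∉⊥
  ; face-v = λ k 0∈ i i∈ → 0≢suc (trans (x∈⁅y⁆⇒x≡y k 0∈) (sym (x∈⁅y⁆⇒x≡y k i∈)))
  ; down   = λ σ⊆τ τ-face 0∈σ i i∈σ → τ-face (σ⊆τ 0∈σ) i (σ⊆τ i∈σ)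
  }
  where
  0≢suc : ∀ {i : Fin 4} → zero ≢ suc i
  0≢suc ()

tetrahedronEdge-isFace : ∀ k l → PointOrTetrahedronFace (⁅ suc k ⁆ ∪ ⁅ suc l ⁆)
tetrahedronEdge-isFace k l 0∈ with x∈p∪q⁻ ⁅ suc k ⁆ ⁅ suc l ⁆ 0∈
... | inj₁ 0∈⁅k⁆ with () ← x∈⁅y⁆⇒x≡y (suc k) 0∈⁅k⁆
... | inj₂ 0∈⁅l⁆ with () ← x∈⁅y⁆⇒x≡y (suc l) 0∈⁅l⁆

module _ (G : Multigraph) (P : FacePosetIsoPathPoset pointAndTetrahedron G) where
  open PosetIso P
  open SimplicialComplex pointAndTetrahedron using (face-∅; face-v)
  open Atoms P face-∅ (∅-isMultipath G) face-v (⁅⁆-isMultipath G)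

  isolated-conflicts : ∀ k → Conflict G (atom zero) (atom (suc k))
  isolated-conflicts k with conflict⊎pair-isMultipath G (atom zero) (atom (suc k))
  ... | inj₁ c  = c
  ... | inj₂ mp = ⊥-elim (g-in _ mp (atom∈⇒∈g _ mp (x∈p∪q⁺ (inj₁ (x∈⁅x⁆ _)))) k
                                    (atom∈⇒∈g _ mp (x∈p∪q⁺ {p = ⁅ atom zero ⁆} (inj₂ (x∈⁅x⁆ _)))))

  tetrahedron-conflictFree : ∀ {k l} → k ≢ l → ¬ Conflict G (atom (suc k)) (atom (suc l))
  tetrahedron-conflictFree {k} {l} k≢l =
    multipath-conflictFree G (f-in _ kl-face)
      (atom∈f _ kl-face (x∈p∪q⁺ (inj₁ (x∈⁅x⁆ _))))
      (atom∈f _ kl-face (x∈p∪q⁺ {p = ⁅ suc k ⁆} (inj₂ (x∈⁅x⁆ _))))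
      (k≢l ∘ suc-injective ∘ atom-injective)
    where
    kl-face : PointOrTetrahedronFace (⁅ suc k ⁆ ∪ ⁅ suc l ⁆)
    kl-face = tetrahedronEdge-isFace k l

pointAndTetrahedron-notPathPoset : ∀ G → ¬ FacePosetIsoPathPoset pointAndTetrahedron G
pointAndTetrahedron-notPathPoset G P
  with i , j , i<j , sameKind ← pigeonhole (n<1+n 3) (conflictKind G ∘ isolated-conflicts G P)
  = tetrahedron-conflictFree G P (<⇒≢ i<j)
      (sameKind⇒conflict G (isolated-conflicts G P i) (isolated-conflicts G P j) sameKind)

proposition6p20 : Σ SimplicialComplex λ Y →
    ((G : Multigraph) → ¬ FacePosetIsoPathPoset Y G)
    × ((G : Multigraph) → ¬ IsoMultipathComplex Y G)
proposition6p20 =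
  pointAndTetrahedron ,
  pointAndTetrahedron-notPathPoset ,
  λ G → pointAndTetrahedron-notPathPoset G ∘ SCIso⇒PosetIso
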